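{- Let $O\colon \{0,1\}^n\to\{ -,0,+\}^n$ be a partial orientation of the $n$-dimensional hypercube $Q_n$ which is partially Szab\'o-Welzl. Then $O$ can be extended to a unique sink orientation, i.e., there is a unique sink orientation $O'\colon\{0,1\}^n\to\{ -,+\}^n$ with $O'(v)_i=O(v)_i$ whenever $O(v)_i\neq 0$.
   Context: The $n$-cube $Q_n$ has vertex set $\{0,1\}^n$, two vertices being adjacent iff they differ in exactly one coordinate. A partial orientation is a function $O\colon\{0,1\}^n\to\{ -,0,+\}^n$; $O(v)_i=+$ means the half-edge at $v$ in dimension $i$ is outgoing, $O(v)_i=-$ incoming, and $O(v)_i=0$ unoriented. An orientation is a partial orientation with values in $\{ -,+\}^n$. A face (subcube) is a set of vertices obtained by fixing some coordinates; a unique sink orientation (USO) is an orientation in which every non-empty face $f$ contains exactly one vertex $v$ with $O(v)_i=-$ for all dimensions $i$ spanned by $f$. A partial orientation $O$ is partially Szab\'o-Welzl if for any two distinct vertices $v,w$, either (1) $O(v)_i=O(w)_i=0$ for all $i$ with $v_i\neq w_i$, or (2) there exists $i$ with $v_i\neq w_i$ and $\{O(v)_i,O(w)_i\}=\{ -,+\}$. -}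

module Defs where

open import Data.Nat using (ℕ)
open import Data.Fin using (Fin)
open import Data.Bool using (Bool; true; false)
open import Data.Product using (Σ; _×_; ∃; ∃-syntax)
open import Data.Sum using (_⊎_)
open import Relation.Binary.PropositionalEquality using (_≡_; _≢_)
open import Relation.Nullary using (¬_)

data Sign : Set where
  minus zero plus : Sign

Vertex : ℕ → Set
Vertex n = Fin n → Bool

_≈V_ : ∀ {n} → Vertex n → Vertex n → Set
v ≈V w = ∀ i → v i ≡ w i

PartialOrientation : ℕ → Set
PartialOrientation n = Vertex n → Fin n → Sign

data Oriented : Sign → Set where
  minus-or : Oriented minus
  plus-or  : Oriented plus

IsOrientation : ∀ {n} → PartialOrientation n → Set
IsOrientation {n} O = ∀ (v : Vertex n) (i : Fin n) → Oriented (O v i)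

-- A face (subcube) is given by a set S of free dimensions and a base vertex u;
-- its vertices are those w agreeing with u on every fixed coordinate.
-- (Every such face is non-empty, since it contains u.)
InFace : ∀ {n} → (S : Fin n → Bool) → (u : Vertex n) → Vertex n → Set
InFace S u w = ∀ i → S i ≡ false → w i ≡ u i

IsSinkIn : ∀ {n} → PartialOrientation n → (S : Fin n → Bool) → Vertex n → Set
IsSinkIn O S v = ∀ i → S i ≡ true → O v i ≡ minus

IsUSO : ∀ {n} → PartialOrientation n → Set
IsUSO {n} O =
  IsOrientation O ×
  (∀ (S : Fin n → Bool) (u : Vertex n) →
     Σ (Vertex n) λ v →
       (InFace S u v × IsSinkIn O S v) ×
       (∀ w → InFace S u w → IsSinkIn O S w → w ≈V v))

OppositeSigns : Sign → Sign → Set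
OppositeSigns a b = (a ≡ minus × b ≡ plus) ⊎ (a ≡ plus × b ≡ minus)

IsPartiallySW : ∀ {n} → PartialOrientation n → Set
IsPartiallySW {n} O =
  ∀ (v w : Vertex n) → ¬ (v ≈V w) →
    (∀ i → v i ≢ w i → (O v i ≡ zero × O w i ≡ zero))
    ⊎ (∃[ i ] (v i ≢ w i × OppositeSigns (O v i) (O w i)))

Extends : ∀ {n} → PartialOrientation n → PartialOrientation n → Set
Extends {n} O' O = ∀ (v : Vertex n) (i : Fin n) → O v i ≢ zero → O' v i ≡ O v i

{-# OPTIONS --safe #-}
module Submission where

open import Defs
open import Data.Nat using (ℕ)
open import Data.Product using (Σ; _×_; _,_; ∃-syntax)
open import Data.Sum using (inj₁; inj₂)
open import Data.Bool using (Bool; true; false; not)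
open import Data.Bool.Properties using (not-¬) renaming (_≟_ to _≟B_)
open import Data.Fin using (Fin)
open import Data.Fin.Properties using (¬∀⟶∃¬) renaming (_≟_ to _≟F_)
open import Data.List using (List; []; _∷_; allFin)
open import Data.List.Membership.Propositional using (_∈_)
open import Data.List.Membership.Propositional.Properties using (∈-allFin)
open import Data.List.Relation.Unary.Any using (here; there)
open import Data.Vec.Functional using (updateAt)
open import Data.Vec.Functional.Properties using (updateAt-updates; updateAt-minimal)
open import Function using (const)
open import Relation.Nullary using (¬_; Dec; yes; no; contradiction)
open import Relation.Binary.PropositionalEquality using (_≡_; _≢_; refl; sym; trans)

-- Fill every unoriented edge upwards (from its 0-end to its 1-end). Two distinct
-- vertices that the partial orientation does not separate differ only in
-- unoriented coordinates, and in each of those the filled signs are opposite;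
-- so the completion is Szabó–Welzl. In a Szabó–Welzl orientation two
-- sinks of one face can only be separated in a fixed coordinate, where they agree,
-- so sinks are unique; and a sink of a face exists by splitting along a free
-- dimension j: of the sinks of the two halves, one has its j-edge incoming,
-- since otherwise nothing would separate them.

IsSzaboWelzl : ∀ {n} → PartialOrientation n → Set
IsSzaboWelzl {n} O = ∀ (v w : Vertex n) → ¬ (v ≈V w) →
  ∃[ i ] (v i ≢ w i × OppositeSigns (O v i) (O w i))

opposite⇒orientedˡ : ∀ {a b} → OppositeSigns a b → Oriented a
opposite⇒orientedˡ (inj₁ (refl , _)) = minus-or
opposite⇒orientedˡ (inj₂ (refl , _)) = plus-or

minus? : (s : Sign) → Dec (s ≡ minus)
minus? minus = yes refl
minus? zero = no λ ()
minus? plus = no λ ()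

¬opposite-minus : ∀ {a b} → a ≡ minus → b ≡ minus → ¬ OppositeSigns a b
¬opposite-minus refl refl (inj₁ (_ , ()))
¬opposite-minus refl refl (inj₂ (() , _))

¬opposite-nonminus : ∀ {a b} → a ≢ minus → b ≢ minus → ¬ OppositeSigns a b
¬opposite-nonminus a≢- _ (inj₁ (a≡- , _)) = a≢- a≡-
¬opposite-nonminus _ b≢- (inj₂ (_ , b≡-)) = b≢- b≡-

module SzaboWelzl {n : ℕ} {O : PartialOrientation n} (sw : IsSzaboWelzl O) where

  flip : Fin n → Vertex n → Vertex n
  flip j u = updateAt u j not

  freeze : Fin n → (Fin n → Bool) → Fin n → Bool
  freeze j S = updateAt S j (const false)

  FaceSink : (Fin n → Bool) → Vertex n → Set
  FaceSink S u = Σ (Vertex n) λ v → InFace S u v × IsSinkIn O S v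

  isOrientation : IsOrientation O
  isOrientation v i with sw v (flip i v) (λ v≈v' → not-¬ refl (trans (v≈v' i) (updateAt-updates i v)))
  ... | k , v≢v' , opp with k ≟F i
  ...   | yes refl = opposite⇒orientedˡ opp
  ...   | no k≢i = contradiction (sym (updateAt-minimal k i v k≢i)) v≢v'

  sinks-equal : ∀ {S v w} → IsSinkIn O S v → IsSinkIn O S w →
    (∀ i → v i ≢ w i → S i ≡ false → ¬ OppositeSigns (O v i) (O w i)) → v ≈V w
  sinks-equal {S} {v} {w} v-sink w-sink separated⇒free i with v i ≟B w i
  ... | yes vi≡wi = vi≡wi
  ... | no vi≢wi with sw v w (λ v≈w → vi≢wi (v≈w i))
  ...   | k , vk≢wk , opp with S k in Sk
  ...     | true = contradiction opp (¬opposite-minus (v-sink k Sk) (w-sink k Sk))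
  ...     | false = contradiction opp (separated⇒free k vk≢wk Sk)

  sink-unique : ∀ {S u v w} → InFace S u v → IsSinkIn O S v →
    InFace S u w → IsSinkIn O S w → w ≈V v
  sink-unique v-in v-sink w-in w-sink = sinks-equal w-sink v-sink
    λ i wi≢vi Si≡false → contradiction (trans (w-in i Si≡false) (sym (v-in i Si≡false))) wi≢vi

  freeze-fixed : ∀ j S {i} → S i ≡ false → freeze j S i ≡ false
  freeze-fixed j S {i} Si with i ≟F j
  ... | yes refl = updateAt-updates j S
  ... | no i≢j = trans (updateAt-minimal i j S i≢j) Si

  fixed≢free : ∀ {S : Fin n → Bool} {i j} → S i ≡ false → S j ≡ true → i ≢ j
  fixed≢free Si Sj refl with trans (sym Si) Sj
  ... | ()

  extend-sink : ∀ {S j v} → IsSinkIn O (freeze j S) v → O v j ≡ minus → IsSinkIn O S v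
  extend-sink {S} {j} v-sink Ovj i Si with i ≟F j
  ... | yes refl = Ovj
  ... | no i≢j = v-sink i (trans (updateAt-minimal i j S i≢j) Si)

  sink-from-halves : ∀ {S j u} → S j ≡ true →
    FaceSink (freeze j S) u → FaceSink (freeze j S) (flip j u) → FaceSink S u
  sink-from-halves {S} {j} {u} Sj (v₀ , v₀-in , v₀-sink) (v₁ , v₁-in , v₁-sink)
    with minus? (O v₀ j) | minus? (O v₁ j)
  ... | yes O₀ | _ = v₀ , (λ i Si → v₀-in i (freeze-fixed j S Si)) , extend-sink v₀-sink O₀
  ... | no _ | yes O₁ = v₁ , v₁-in′ , extend-sink v₁-sink O₁
    where
      v₁-in′ : InFace S u v₁
      v₁-in′ i Si = trans (v₁-in i (freeze-fixed j S Si)) (updateAt-minimal i j u (fixed≢free Si Sj))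
  ... | no O₀ | no O₁ = contradiction (v₀≈v₁ j) v₀j≢v₁j
    where
      v₀j≢v₁j : v₀ j ≢ v₁ j
      v₀j≢v₁j v₀j≡v₁j = not-¬ refl (trans (sym (v₀-in j (updateAt-updates j S)))
        (trans v₀j≡v₁j (trans (v₁-in j (updateAt-updates j S)) (updateAt-updates j u))))

      only-j-separates : ∀ i → v₀ i ≢ v₁ i → freeze j S i ≡ false → ¬ OppositeSigns (O v₀ i) (O v₁ i)
      only-j-separates i v₀i≢v₁i S′i with i ≟F j
      ... | yes refl = ¬opposite-nonminus O₀ O₁
      ... | no i≢j = contradiction
        (trans (v₀-in i S′i) (sym (trans (v₁-in i S′i) (updateAt-minimal i j u i≢j)))) v₀i≢v₁i

      v₀≈v₁ : v₀ ≈V v₁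
      v₀≈v₁ = sinks-equal v₀-sink v₁-sink only-j-separates

  sink-exists-within : (L : List (Fin n)) (S : Fin n → Bool) → (∀ i → S i ≡ true → i ∈ L) →
    ∀ u → FaceSink S u
  sink-exists-within [] S free⊆L u = u , (λ _ _ → refl) , λ i Si → contradiction (free⊆L i Si) λ ()
  sink-exists-within (j ∷ L) S free⊆j∷L u with S j in Sj
  ... | false = sink-exists-within L S free⊆L u
    where
      free⊆L : ∀ i → S i ≡ true → i ∈ L
      free⊆L i Si with free⊆j∷L i Si
      ... | here refl = contradiction (trans (sym Sj) Si) λ ()
      ... | there i∈L = i∈L
  ... | true = sink-from-halves Sj (halves u) (halves (flip j u))
    where
      frozen⊆L : ∀ i → freeze j S i ≡ true → i ∈ L
      frozen⊆L i S′i with i ≟F j | free⊆j∷L i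
      ... | yes refl | _ = contradiction (trans (sym (updateAt-updates j S)) S′i) λ ()
      ... | no i≢j | free⇒∈ with free⇒∈ (trans (sym (updateAt-minimal i j S i≢j)) S′i)
      ...   | here i≡j = contradiction i≡j i≢j
      ...   | there i∈L = i∈L

      halves : ∀ u′ → FaceSink (freeze j S) u′
      halves = sink-exists-within L (freeze j S) frozen⊆L

  isUSO : IsUSO O
  isUSO = isOrientation , λ S u →
    let v , v-in , v-sink = sink-exists-within (allFin n) S (λ i _ → ∈-allFin i) u
    in v , (v-in , v-sink) , λ w w-in w-sink → sink-unique v-in v-sink w-in w-sink

upward : Bool → Sign
upward false = plus
upward true = minus

fill : Sign → Bool → Sign
fill minus _ = minus
fill zero b = upward b
fill plus _ = plus

complete : ∀ {n} → PartialOrientation n → PartialOrientation n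
complete O v i = fill (O v i) (v i)

upward-opposite : ∀ {x y} → x ≢ y → OppositeSigns (upward x) (upward y)
upward-opposite {false} {false} x≢y = contradiction refl x≢y
upward-opposite {false} {true} _ = inj₂ (refl , refl)
upward-opposite {true} {false} _ = inj₁ (refl , refl)
upward-opposite {true} {true} x≢y = contradiction refl x≢y

fill-zero-opposite : ∀ {a b x y} → a ≡ zero → b ≡ zero → x ≢ y → OppositeSigns (fill a x) (fill b y)
fill-zero-opposite refl refl = upward-opposite

fill-opposite : ∀ {a b x y} → OppositeSigns a b → OppositeSigns (fill a x) (fill b y)
fill-opposite (inj₁ (refl , refl)) = inj₁ (refl , refl)
fill-opposite (inj₂ (refl , refl)) = inj₂ (refl , refl)

complete-extends : ∀ {n} (O : PartialOrientation n) → Extends (complete O) O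
complete-extends O v i Ovi≢0 with O v i
... | minus = refl
... | zero = contradiction refl Ovi≢0
... | plus = refl

complete-isSzaboWelzl : ∀ {n} (O : PartialOrientation n) → IsPartiallySW O → IsSzaboWelzl (complete O)
complete-isSzaboWelzl {n} O psw v w v≉w with psw v w v≉w
... | inj₂ (i , vi≢wi , opp) = i , vi≢wi , fill-opposite opp
... | inj₁ unoriented with ¬∀⟶∃¬ n _ (λ i → v i ≟B w i) v≉w
...   | i , vi≢wi with unoriented i vi≢wi
...     | Ovi≡0 , Owi≡0 = i , vi≢wi , fill-zero-opposite Ovi≡0 Owi≡0 vi≢wi

lemma3p2 : (n : ℕ) (O : PartialOrientation n) → IsPartiallySW O →
    Σ (PartialOrientation n) (λ O' → IsUSO O' × Extends O' O)
lemma3p2 n O psw = complete O , SzaboWelzl.isUSO (complete-isSzaboWelzl O psw) , complete-extends O
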